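{- Let $G=(V,E)$ be a directed graph with monitor placement $\chi=(\mathfrak m,\mathfrak M)$. Under either the $\mathrm{CSP}$ or the $\mathrm{CAP}^-$ routing mechanism, $\mu(G\mid\chi)\le\hat\delta(G)$, where $\hat\delta(G)=\min\{\min_{v\in R}\deg_{\mathtt i}(v),\ \min_{v\in K}(\deg_{\mathtt i}(v)+\deg_{\mathtt o}(v))\}$.
   Context: For a node $v$ of a directed graph, $\deg_{\mathtt i}(v)$ is its in-degree and $\deg_{\mathtt o}(v)$ its out-degree. A monitor placement $\chi=(\mathfrak m,\mathfrak M)$ specifies a set $\mathfrak m\subseteq V$ of input nodes and a set $\mathfrak M\subseteq V$ of output nodes. A node $v$ is a complex source if $v\in\mathfrak m$ and $\deg_{\mathtt i}(v)>0$, and a simple source if $v\in\mathfrak m$ and $\deg_{\mathtt i}(v)=0$. $K$ is the set of complex sources, $L$ the set of simple sources, and $R=V\setminus(K\cup L)$. The set of measurement paths $\mathbb P(G\mid\chi)$ (directed paths, following edge directions) depends on the routing mechanism: under $\mathrm{CSP}$ it consists of all simple directed paths from a node of $\mathfrak m$ to a different node of $\mathfrak M$; under $\mathrm{CAP}^-$ it consists of all directed walks (repeated nodes/edges allowed) starting at a node of $\mathfrak m$ and ending at a node of $\mathfrak M$, except the single-node path consisting of one node $v\in\mathfrak m\cap\mathfrak M$. For a node $v$, $\mathbb P(v)$ is the set of measurement paths through $v$, and $\mathbb P(U)=\bigcup_{u\in U}\mathbb P(u)$. $V$ is $k$-identifiable if for all $U,W\subseteq V$ with $U\neq W$ and $|U|,|W|\le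 k$, $\mathbb P(U)\neq\mathbb P(W)$. $\mu(G\mid\chi)$ is the largest $k\ge0$ such that $V$ is $k$-identifiable with respect to $\mathbb P(G\mid\chi)$. -}

module Defs where

open import Data.Nat using (ℕ; _≤_; _+_; _>_)
open import Data.Bool using (Bool; true; false)
open import Data.Fin using (Fin)
open import Data.Fin.Subset using (Subset; _∈_; _∉_; ∣_∣)
open import Data.Vec using (tabulate)
open import Data.List using (List; []; _∷_)
open import Data.List.NonEmpty using (List⁺; _∷_; head; last; toList; length)
import Data.List.Membership.Propositional as LM
open import Data.List.Relation.Unary.Unique.Propositional using (Unique)
open import Data.Product using (_×_; ∃-syntax)
open import Data.Unit using (⊤)
open import Data.Empty using (⊥)
open import Relation.Binary.PropositionalEquality using (_≡_; _≢_)
open import Relation.Nullary using (¬_)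
open import Function.Bundles using (_⇔_)

-- A (simple, loopless) directed graph on the node set V = Fin n,
-- given by its adjacency relation: E u v ≡ true iff (u , v) is an edge.
record Digraph (n : ℕ) : Set where
  field
    E        : Fin n → Fin n → Bool
    loopless : ∀ v → E v v ≡ false
open Digraph public

module _ {n : ℕ} (G : Digraph n) where

  inNbrs : Fin n → Subset n
  inNbrs v = tabulate (λ u → E G u v)

  outNbrs : Fin n → Subset n
  outNbrs v = tabulate (λ w → E G v w)

  deg-i : Fin n → ℕ
  deg-i v = ∣ inNbrs v ∣

  deg-o : Fin n → ℕ
  deg-o v = ∣ outNbrs v ∣

  WalkL : List (Fin n) → Set
  WalkL []           = ⊤
  WalkL (x ∷ [])     = ⊤
  WalkL (x ∷ y ∷ ys) = (E G x y ≡ true) × WalkL (y ∷ ys)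

  IsWalk : List⁺ (Fin n) → Set
  IsWalk p = WalkL (toList p)

record Placement (n : ℕ) : Set where
  constructor ⟨_,_⟩
  field
    inputs  : Subset n
    outputs : Subset n
open Placement public

data Routing : Set where
  CSP CAP⁻ : Routing

Path : ℕ → Set
Path n = List⁺ (Fin n)

MeasPath : ∀ {n} → Routing → Digraph n → Placement n → Path n → Set
MeasPath CSP G χ p =
  IsWalk G p × Unique (toList p) ×
  head p ∈ inputs χ × last p ∈ outputs χ × head p ≢ last p
MeasPath CAP⁻ G χ p =
  IsWalk G p × head p ∈ inputs χ × last p ∈ outputs χ ×
  ¬ (length p ≡ 1)

PathsThrough : ∀ {n} → Routing → Digraph n → Placement n → Subset n → Path n → Set
PathsThrough r G χ U p = MeasPath r G χ p × ∃[ u ] (u ∈ U × u LM.∈ toList p)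

Identifiable : ∀ {n} → Routing → Digraph n → Placement n → ℕ → Set
Identifiable r G χ k =
  ∀ (U W : Subset _) → U ≢ W → ∣ U ∣ ≤ k → ∣ W ∣ ≤ k →
  ¬ (∀ p → PathsThrough r G χ U p ⇔ PathsThrough r G χ W p)

-- complex sources K, simple sources L, and R = V ∖ (K ∪ L)
IsComplexSource : ∀ {n} → Digraph n → Placement n → Fin n → Set
IsComplexSource G χ v = v ∈ inputs χ × deg-i G v > 0

IsSimpleSource : ∀ {n} → Digraph n → Placement n → Fin n → Set
IsSimpleSource G χ v = v ∈ inputs χ × deg-i G v ≡ 0

InR : ∀ {n} → Digraph n → Placement n → Fin n → Set
InR G χ v = ¬ IsComplexSource G χ v × ¬ IsSimpleSource G χ v

-- k ≤ δ̂(G), with δ̂(G) = min { min_{v∈R} deg_i v , min_{v∈K} (deg_i v + deg_o v) }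
-- (min over an empty set = +∞, so the corresponding constraint is vacuous)
≤δ̂ : ∀ {n} → Digraph n → Placement n → ℕ → Set
≤δ̂ G χ k =
  (∀ v → InR G χ v → k ≤ deg-i G v) ×
  (∀ v → IsComplexSource G χ v → k ≤ deg-i G v + deg-o G v)

-- μ(G ∣ χ) ≤ δ̂(G): μ is the largest k with V k-identifiable, so this says
-- every k for which V is k-identifiable satisfies k ≤ δ̂(G).
μ≤δ̂ : ∀ {n} → Routing → Digraph n → Placement n → Set
μ≤δ̂ r G χ = ∀ k → Identifiable r G χ k → ≤δ̂ G χ k

module Submission where

-- Suppose a node v and a set S with v ∉ S are such that every
-- measurement path through v also passes through S ("S covers v").  Then
-- the sets S and ⁅ v ⁆ ∪ S are traversed by exactly the same measurement
-- paths, while they differ and have at most ∣ S ∣ + 1 elements; hence V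
-- cannot be k-identifiable for any k > ∣ S ∣, i.e. k-identifiability
-- forces k ≤ ∣ S ∣.
--
-- It remains to exhibit covering sets of the right size:
--   * v ∈ R is not an input, so a measurement path through v does not start
--     at v; the node just before v is an in-neighbour: S = inNbrs v.
--   * v ∈ K: every measurement path has at least two nodes, so the node
--     just before or just after v is a neighbour: S = inNbrs v ∪ outNbrs v,
--     of size at most deg-i v + deg-o v.

open import Defs
open import Data.Nat using (ℕ; zero; suc; _≤_; _<_; _+_; z≤n; s≤s)
open import Data.Nat.Properties
  using (≤-trans; ≤-reflexive; <⇒≤; ≮⇒≥; +-monoʳ-≤; +-suc; n≤1+n)
open import Data.Bool using (Bool; true; false)
open import Data.Fin using (Fin; _≟_)
open import Data.Fin.Subset using (Subset; _∈_; _∉_; ∣_∣; _∪_; ⁅_⁆)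
open import Data.Fin.Subset.Properties
  using (x∈p∪q⁻; x∈p∪q⁺; x∈⁅x⁆; x∈⁅y⁆⇒x≡y; ∣⁅x⁆∣≡1; q⊆p∪q)
open import Data.Vec using ([]; _∷_; tabulate)
open import Data.Vec.Properties using (lookup⇒[]=; []=⇒lookup; lookup∘tabulate)
open import Data.List using ([]; _∷_)
open import Data.List.NonEmpty using (_∷_; head; toList)
import Data.List.Membership.Propositional as List
open import Data.List.Relation.Unary.Any using (here; there)
open import Data.Product using (_×_; _,_; ∃-syntax; proj₁)
open import Data.Sum using (_⊎_; inj₁; inj₂)
open import Data.Empty using (⊥-elim)
open import Relation.Binary.PropositionalEquality
  using (_≡_; _≢_; refl; sym; trans; cong; subst)
open import Relation.Nullary using (¬_; yes; no)
open import Function.Bundles using (_⇔_; mk⇔)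

∣p∪q∣≤∣p∣+∣q∣ : ∀ {n} (p q : Subset n) → ∣ p ∪ q ∣ ≤ ∣ p ∣ + ∣ q ∣
∣p∪q∣≤∣p∣+∣q∣ []          []          = z≤n
∣p∪q∣≤∣p∣+∣q∣ (true ∷ p)  (true ∷ q)  =
  s≤s (≤-trans (∣p∪q∣≤∣p∣+∣q∣ p q) (+-monoʳ-≤ ∣ p ∣ (n≤1+n ∣ q ∣)))
∣p∪q∣≤∣p∣+∣q∣ (true ∷ p)  (false ∷ q) = s≤s (∣p∪q∣≤∣p∣+∣q∣ p q)
∣p∪q∣≤∣p∣+∣q∣ (false ∷ p) (true ∷ q)  =
  subst (suc ∣ p ∪ q ∣ ≤_) (sym (+-suc ∣ p ∣ ∣ q ∣)) (s≤s (∣p∪q∣≤∣p∣+∣q∣ p q))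
∣p∪q∣≤∣p∣+∣q∣ (false ∷ p) (false ∷ q) = ∣p∪q∣≤∣p∣+∣q∣ p q

∈-tabulate⁺ : ∀ {n} (f : Fin n → Bool) u → f u ≡ true → u ∈ tabulate f
∈-tabulate⁺ f u fu = lookup⇒[]= u (tabulate f) (trans (lookup∘tabulate f u) fu)

∈-tabulate⁻ : ∀ {n} (f : Fin n → Bool) u → u ∈ tabulate f → f u ≡ true
∈-tabulate⁻ f u u∈ = trans (sym (lookup∘tabulate f u)) ([]=⇒lookup u∈)

module _ {n} (G : Digraph n) where

  no-self-edge : ∀ v → E G v v ≢ true
  no-self-edge v e with trans (sym e) (loopless G v)
  ... | ()

  ∉inNbrs-self : ∀ v → v ∉ inNbrs G v
  ∉inNbrs-self v v∈ = no-self-edge v (∈-tabulate⁻ (λ u → E G u v) v v∈)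

  ∉outNbrs-self : ∀ v → v ∉ outNbrs G v
  ∉outNbrs-self v v∈ = no-self-edge v (∈-tabulate⁻ (E G v) v v∈)

  ∉nbrs-self : ∀ v → v ∉ inNbrs G v ∪ outNbrs G v
  ∉nbrs-self v v∈ with x∈p∪q⁻ (inNbrs G v) (outNbrs G v) v∈
  ... | inj₁ v∈in  = ∉inNbrs-self v v∈in
  ... | inj₂ v∈out = ∉outNbrs-self v v∈out

  walk-visits-in-neighbour : ∀ v x xs → WalkL G (x ∷ xs) → v List.∈ (x ∷ xs) →
    x ≢ v → ∃[ u ] (E G u v ≡ true × u List.∈ (x ∷ xs))
  walk-visits-in-neighbour v x xs        _       (here v≡x)  x≢v = ⊥-elim (x≢v (sym v≡x))
  walk-visits-in-neighbour v x (y ∷ ys) (xy , w) (there v∈) x≢v with y ≟ v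
  ... | yes refl = x , xy , here refl
  ... | no y≢v with walk-visits-in-neighbour v y ys w v∈ y≢v
  ...   | u , uv , u∈ = u , uv , there u∈

  walk-visits-neighbour : ∀ v x y ys → WalkL G (x ∷ y ∷ ys) → v List.∈ (x ∷ y ∷ ys) →
    ∃[ u ] ((E G u v ≡ true ⊎ E G v u ≡ true) × u List.∈ (x ∷ y ∷ ys))
  walk-visits-neighbour v x y ys       (xy , _) (here refl)         = y , inj₂ xy , there (here refl)
  walk-visits-neighbour v x y ys       (xy , _) (there (here refl)) = x , inj₁ xy , here refl
  walk-visits-neighbour v x y (z ∷ zs) (_  , w) (there (there v∈))
    with walk-visits-neighbour v y z zs w (there v∈)
  ... | u , uv , u∈ = u , uv , there u∈

module _ {n} {G : Digraph n} {χ : Placement n} where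

  meas-walk : ∀ r p → MeasPath r G χ p → IsWalk G p
  meas-walk CSP  p mp = proj₁ mp
  meas-walk CAP⁻ p mp = proj₁ mp

  meas-starts-at-input : ∀ r p → MeasPath r G χ p → head p ∈ inputs χ
  meas-starts-at-input CSP  p (_ , _ , h , _) = h
  meas-starts-at-input CAP⁻ p (_ , h , _)     = h

  meas-nontrivial : ∀ r x → ¬ MeasPath r G χ (x ∷ [])
  meas-nontrivial CSP  x (_ , _ , _ , _ , x≢x) = x≢x refl
  meas-nontrivial CAP⁻ x (_ , _ , _ , len≢1)   = len≢1 refl

-- Nodes of R are not inputs: an input is a simple or a complex source.
R-not-input : ∀ {n} (G : Digraph n) (χ : Placement n) v → InR G χ v → v ∉ inputs χ
R-not-input G χ v (¬complex , ¬simple) v∈m with deg-i G v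
... | zero  = ¬simple (v∈m , refl)
... | suc _ = ¬complex (v∈m , s≤s z≤n)

Covers : ∀ {n} → Routing → Digraph n → Placement n → Subset n → Fin n → Set
Covers r G χ S v =
  ∀ p → MeasPath r G χ p → v List.∈ toList p → ∃[ u ] (u ∈ S × u List.∈ toList p)

module _ {n} (r : Routing) (G : Digraph n) (χ : Placement n) where

  covered-node-invisible : ∀ S v → Covers r G χ S v →
    ∀ p → PathsThrough r G χ S p ⇔ PathsThrough r G χ (⁅ v ⁆ ∪ S) p
  covered-node-invisible S v cover p = mk⇔ widen narrow
    where
    widen : PathsThrough r G χ S p → PathsThrough r G χ (⁅ v ⁆ ∪ S) p
    widen (mp , u , u∈S , u∈p) = mp , u , q⊆p∪q ⁅ v ⁆ S u∈S , u∈p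

    narrow : PathsThrough r G χ (⁅ v ⁆ ∪ S) p → PathsThrough r G χ S p
    narrow (mp , u , u∈W , u∈p) with x∈p∪q⁻ ⁅ v ⁆ S u∈W
    ... | inj₁ u∈⁅v⁆ = mp , cover p mp (subst (List._∈ toList p) (x∈⁅y⁆⇒x≡y v u∈⁅v⁆) u∈p)
    ... | inj₂ u∈S   = mp , u , u∈S , u∈p

  -- A covering set S ∌ v bounds the identifiability: S and ⁅ v ⁆ ∪ S are
  -- distinct, indistinguishable, and of size at most ∣ S ∣ + 1.
  covering-bound : ∀ k S v → v ∉ S → Covers r G χ S v →
    Identifiable r G χ k → k ≤ ∣ S ∣
  covering-bound k S v v∉S cover ident = ≮⇒≥ too-large
    where
    too-large : ¬ (∣ S ∣ < k)
    too-large ∣S∣<k = ident S (⁅ v ⁆ ∪ S) S≢W (<⇒≤ ∣S∣<k) ∣W∣≤k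
      (covered-node-invisible S v cover)
      where
      S≢W : S ≢ ⁅ v ⁆ ∪ S
      S≢W S≡W = v∉S (subst (v ∈_) (sym S≡W) (x∈p∪q⁺ (inj₁ (x∈⁅x⁆ v))))

      ∣W∣≤k : ∣ ⁅ v ⁆ ∪ S ∣ ≤ k
      ∣W∣≤k = ≤-trans (∣p∪q∣≤∣p∣+∣q∣ ⁅ v ⁆ S)
                (≤-trans (≤-reflexive (cong (_+ ∣ S ∣) (∣⁅x⁆∣≡1 v))) ∣S∣<k)

  inNbrs-cover-non-input : ∀ v → v ∉ inputs χ → Covers r G χ (inNbrs G v) v
  inNbrs-cover-non-input v v∉m (x ∷ xs) mp v∈p
    with walk-visits-in-neighbour G v x xs (meas-walk r (x ∷ xs) mp) v∈p x≢v
    where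
    x≢v : x ≢ v
    x≢v refl = v∉m (meas-starts-at-input r (x ∷ xs) mp)
  ... | u , uv , u∈p = u , ∈-tabulate⁺ (λ w → E G w v) u uv , u∈p

  nbrs-cover : ∀ v → Covers r G χ (inNbrs G v ∪ outNbrs G v) v
  nbrs-cover v (x ∷ [])     mp _ = ⊥-elim (meas-nontrivial r x mp)
  nbrs-cover v (x ∷ y ∷ ys) mp v∈p
    with walk-visits-neighbour G v x y ys (meas-walk r (x ∷ y ∷ ys) mp) v∈p
  ... | u , inj₁ uv , u∈p = u , x∈p∪q⁺ (inj₁ (∈-tabulate⁺ (λ w → E G w v) u uv)) , u∈p
  ... | u , inj₂ vu , u∈p = u , x∈p∪q⁺ (inj₂ (∈-tabulate⁺ (E G v) u vu)) , u∈p

lemma2 : ∀ {n : ℕ} (r : Routing) (G : Digraph n) (χ : Placement n) → μ≤δ̂ r G χ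
lemma2 r G χ k ident = bound-on-R , bound-on-K
  where
  bound-on-R : ∀ v → InR G χ v → k ≤ deg-i G v
  bound-on-R v v∈R =
    covering-bound r G χ k (inNbrs G v) v (∉inNbrs-self G v)
      (inNbrs-cover-non-input r G χ v (R-not-input G χ v v∈R)) ident

  bound-on-K : ∀ v → IsComplexSource G χ v → k ≤ deg-i G v + deg-o G v
  bound-on-K v _ = ≤-trans
    (covering-bound r G χ k (inNbrs G v ∪ outNbrs G v) v (∉nbrs-self G v)
      (nbrs-cover r G χ v) ident)
    (∣p∪q∣≤∣p∣+∣q∣ (inNbrs G v) (outNbrs G v))
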